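{- Let $G$ be a finite simple graph of order $n \ge 4$ such that both $G$ and $\overline{G}$ are connected. Then $$\delta(G)+n-1-\Delta(G)=\delta(G)+\delta(\overline{G})\le Z(G)+ Z(\overline{G}) \le 2(n-3),$$ and both bounds are sharp, i.e., each bound is attained with equality by some such graph $G$.
   Context: For a finite simple graph $G$, color a set $S\subseteq V(G)$ black and all other vertices white. The color-change rule: if a black vertex $u$ has exactly one white neighbor $w$, then $w$ is turned black. $S$ is a zero forcing set if repeated application of the rule eventually turns all vertices black; $Z(G)$ is the minimum size of a zero forcing set. $\overline{G}$ denotes the complement of $G$; $\delta(G)$ and $\Delta(G)$ denote the minimum and maximum degree of $G$. -}

module Defs where

open import Data.Nat using (ℕ; zero; suc; _+_; _≤_; _⊓_; _⊔_)
open import Data.Bool using (Bool; true; false; not; _∧_; if_then_else_)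
open import Data.Fin using (Fin)
open import Data.Fin.Subset using (Subset; _∈_; _∉_; _∪_; ⁅_⁆; ⊤; ∣_∣)
open import Data.Fin.Properties using (_≟_)
open import Data.List using (List; map; foldr)
open import Data.Nat.ListAction using (sum)
open import Data.List using () renaming (allFin to allFinL)
open import Data.Product using (Σ; _×_; ∃)
open import Relation.Nullary using (¬_)
open import Relation.Nullary.Decidable using (⌊_⌋)
open import Relation.Binary.PropositionalEquality using (_≡_; _≢_; refl; cong)
open import Relation.Nullary using (yes; no)
open import Data.Empty using (⊥-elim)
open import Data.Bool.Properties using (∧-zeroʳ)
open import Relation.Binary.Construct.Closure.ReflexiveTransitive using (Star)

record Graph (n : ℕ) : Set where
  field
    adj   : Fin n → Fin n → Bool
    sym   : ∀ i j → adj i j ≡ adj j i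
    irref : ∀ i → adj i i ≡ false
open Graph public

private
  cadj : ∀ {n} → Graph n → Fin n → Fin n → Bool
  cadj G i j = not (adj G i j) ∧ not ⌊ i ≟ j ⌋

  csym : ∀ {n} (G : Graph n) i j → cadj G i j ≡ cadj G j i
  csym G i j with i ≟ j | j ≟ i | Graph.sym G i j
  ... | yes p    | yes q    | e = cong (λ a → not a ∧ false) e
  ... | yes refl | no q     | e = ⊥-elim (q refl)
  ... | no p     | yes refl | e = ⊥-elim (p refl)
  ... | no p     | no q     | e = cong (λ a → not a ∧ true) e

  cirr : ∀ {n} (G : Graph n) i → cadj G i i ≡ false
  cirr G i with i ≟ i
  ... | yes _ = ∧-zeroʳ (not (adj G i i))
  ... | no ¬p = ⊥-elim (¬p refl)

complement : ∀ {n} → Graph n → Graph n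
complement G = record { adj = cadj G ; sym = csym G ; irref = cirr G }

degree : ∀ {n} → Graph n → Fin n → ℕ
degree {n} G i = sum (map (λ j → if adj G i j then 1 else 0) (allFinL n))

-- Minimum degree δ(G) (degrees are < n, so starting the fold at n is harmless
-- for n ≥ 1) and maximum degree Δ(G).
δ : ∀ {n} → Graph n → ℕ
δ {n} G = foldr _⊓_ n (map (degree G) (allFinL n))

Δ : ∀ {n} → Graph n → ℕ
Δ {n} G = foldr _⊔_ 0 (map (degree G) (allFinL n))

data Reachable {n} (G : Graph n) : Fin n → Fin n → Set where
  here  : ∀ {i} → Reachable G i i
  step  : ∀ {i j k} → adj G i j ≡ true → Reachable G j k → Reachable G i k

Connected : ∀ {n} → Graph n → Set
Connected {n} G = ∀ (i j : Fin n) → Reachable G i j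

-- One application of the colour-change rule: black vertex u has exactly one
-- white neighbour w, which turns black.
data ForceStep {n} (G : Graph n) : Subset n → Subset n → Set where
  force : ∀ {B : Subset n} (u w : Fin n) →
          u ∈ B → w ∉ B → adj G u w ≡ true →
          (∀ x → adj G u x ≡ true → x ≢ w → x ∈ B) →
          ForceStep G B (⁅ w ⁆ ∪ B)

IsZeroForcingSet : ∀ {n} → Graph n → Subset n → Set
IsZeroForcingSet G S = Star (ForceStep G) S ⊤

IsZeroForcingNumber : ∀ {n} → Graph n → ℕ → Set
IsZeroForcingNumber {n} G z =
  (Σ (Subset n) λ S → IsZeroForcingSet G S × ∣ S ∣ ≡ z) ×
  (∀ (S : Subset n) → IsZeroForcingSet G S → z ≤ ∣ S ∣)

-- Lower bound: the first vertex to force is black together with all its neighbours but one, so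
-- Z(G) ≥ δ(G); and the degrees of G and its complement at a vertex add up to n − 1.
--
-- Upper bound: call y, z separated non-neighbours if some v is adjacent to neither of them while
-- some w sees y but not z.  Then, for a neighbour x of v, the complement of {x, y, z} forces:
-- v forces x, w forces y, and any neighbour of z forces z; hence Z(G) ≤ n − 3.  If G had no such
-- configuration, any two vertices with a common non-neighbour would have the same non-neighbours.
-- Starting from an edge v y of the complement, connectivity of the complement then makes every
-- vertex a non-neighbour of v or of y, and connectivity of G makes every vertex, in particular v
-- itself, a non-neighbour of v, which is absurd.
--
-- Both bounds are attained by the path on four vertices, which is self-complementary.
module Submission where

open import Defs hiding (sym)
open import Data.Bool using (Bool; true; false; not; _∨_; if_then_else_)
open import Data.Bool.Properties using (∨-comm; ∧-zeroʳ; ∧-identityʳ; not-involutive; ¬-not)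
  renaming (_≟_ to _≟ᴮ_)
open import Data.Empty using (⊥; ⊥-elim)
open import Data.Fin using (Fin; zero; suc; toℕ; #_)
open import Data.Fin.Properties using (_≟_; any?; all?)
open import Data.Fin.Subset using (Subset; _∈_; _∉_; _∪_; ⁅_⁆; ∁; ⊤; ∣_∣)
open import Data.Fin.Subset.Properties
  using (_∈?_; x∈⁅x⁆; x∈⁅y⁆⇒x≡y; x≢y⇒x∉⁅y⁆; x∈p∪q⁺; x∈p∪q⁻; q⊆p∪q; x∉p⇒x∈∁p; x∈p⇒x∉∁p;
         ⊆⊤; ⊆-antisym; ∣⊤∣≡n; p⊂q⇒∣p∣<∣q∣)
open import Data.List using (List; []; _∷_; map; foldr; tabulate; allFin)
open import Data.List.Membership.Propositional using () renaming (_∈_ to _∈ᴸ_)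
open import Data.List.Membership.Propositional.Properties using (∈-allFin; ∈-map⁺)
open import Data.List.Properties using (map-tabulate; map-cong)
open import Data.List.Relation.Unary.Any using (here; there)
open import Data.Nat using (ℕ; zero; suc; _+_; _*_; _∸_; _≤_; _<_; _⊓_; _⊔_; _≡ᵇ_; z≤n; s≤s)
open import Data.Nat.ListAction using (sum)
open import Data.Nat.Properties hiding (_≟_)
open import Algebra.Properties.CommutativeSemigroup +-commutativeSemigroup using (interchange)
open import Data.Product using (Σ; _×_; _,_; proj₁; proj₂; ∃-syntax)
open import Data.Sum using (_⊎_; inj₁; inj₂; [_,_]′; swap)
open import Data.Vec as Vec using (lookup)
open import Data.Vec.Properties using ([]=⇒lookup)
open import Function using (_∘_; id; case_of_)
open import Relation.Binary.Construct.Closure.ReflexiveTransitive using (ε; _◅_)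
open import Relation.Binary.PropositionalEquality
open import Relation.Nullary using (¬_; Dec; does; yes; no)
open import Relation.Nullary.Decidable using (_×-dec_; _→-dec_; ¬?; True; toWitness;
  decidable-stable)

private
  variable
    n : ℕ
    G : Graph n
    a b c i u w : Fin n
    B B′ S : Subset n
    z : ℕ

𝟙 : Bool → ℕ
𝟙 b = if b then 1 else 0

∑ : (Fin n → ℕ) → ℕ
∑ f = sum (tabulate f)

∑-cong : {f g : Fin n → ℕ} → (∀ i → f i ≡ g i) → ∑ f ≡ ∑ g
∑-cong {zero}  f≗g = refl
∑-cong {suc n} f≗g = cong₂ _+_ (f≗g zero) (∑-cong (f≗g ∘ suc))

∑-mono-≤ : {f g : Fin n → ℕ} → (∀ i → f i ≤ g i) → ∑ f ≤ ∑ g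
∑-mono-≤ {zero}  f≤g = z≤n
∑-mono-≤ {suc n} f≤g = +-mono-≤ (f≤g zero) (∑-mono-≤ (f≤g ∘ suc))

∑-distrib-+ : (f g : Fin n → ℕ) → ∑ (λ i → f i + g i) ≡ ∑ f + ∑ g
∑-distrib-+ {zero}  f g = refl
∑-distrib-+ {suc n} f g = begin
  f zero + g zero + ∑ (λ i → f (suc i) + g (suc i))
    ≡⟨ cong (f zero + g zero +_) (∑-distrib-+ (f ∘ suc) (g ∘ suc)) ⟩
  f zero + g zero + (∑ (f ∘ suc) + ∑ (g ∘ suc))
    ≡⟨ interchange (f zero) (g zero) _ _ ⟩
  f zero + ∑ (f ∘ suc) + (g zero + ∑ (g ∘ suc)) ∎
  where open ≡-Reasoning

∑-const : ∀ n k → ∑ {n} (λ _ → k) ≡ n * k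
∑-const zero    k = refl
∑-const (suc n) k = cong (k +_) (∑-const n k)

∑-𝟙-≟ : (i : Fin n) → ∑ (λ j → 𝟙 (does (i ≟ j))) ≡ 1
∑-𝟙-≟ {suc n} zero    = cong suc (trans (∑-const n 0) (*-zeroʳ n))
∑-𝟙-≟ {suc n} (suc i) = ∑-𝟙-≟ i

∣p∣≡∑ : (p : Subset n) → ∣ p ∣ ≡ ∑ (λ i → 𝟙 (lookup p i))
∣p∣≡∑ Vec.[]           = refl
∣p∣≡∑ (true  Vec.∷ p) = cong suc (∣p∣≡∑ p)
∣p∣≡∑ (false Vec.∷ p) = ∣p∣≡∑ p

Edge : Graph n → Fin n → Fin n → Set
Edge G a b = adj G a b ≡ true

Edge? : (G : Graph n) → ∀ a b → Dec (Edge G a b)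
Edge? G a b = adj G a b ≟ᴮ true

Edge-sym : (G : Graph n) → Edge G a b → Edge G b a
Edge-sym {a = a} {b} G e = trans (Graph.sym G b a) e

Edge-irrefl : (G : Graph n) → Edge G a b → a ≢ b
Edge-irrefl {a = a} G e refl with trans (sym e) (irref G a)
... | ()

complement-Edge⁻ : (G : Graph n) → Edge (complement G) a b → adj G a b ≡ false
complement-Edge⁻ {a = a} {b} G e with adj G a b
complement-Edge⁻ G () | true
complement-Edge⁻ G e  | false = refl

complement-Edge⁺ : (G : Graph n) → a ≢ b → adj G a b ≡ false → Edge (complement G) a b
complement-Edge⁺ {a = a} {b} G a≢b e rewrite e with a ≟ b
... | yes a≡b = ⊥-elim (a≢b a≡b)
... | no _    = refl

Edge-complement-disjoint : (G : Graph n) → Edge G a b → ¬ Edge (complement G) a b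
Edge-complement-disjoint G e ē with trans (sym e) (complement-Edge⁻ G ē)
... | ()

neighbour≢nonNeighbour : (G : Graph n) → Edge G a b → Edge (complement G) a c → b ≢ c
neighbour≢nonNeighbour G ab ac refl = Edge-complement-disjoint G ab ac

complement-involutive : (G : Graph n) → ∀ a b → adj (complement (complement G)) a b ≡ adj G a b
complement-involutive G a b with a ≟ b
... | yes refl = trans (∧-zeroʳ _) (sym (irref G a))
... | no _     = trans (∧-identityʳ _) (trans (cong not (∧-identityʳ _)) (not-involutive _))

Reachable-trans : Reachable G a b → Reachable G b c → Reachable G a c
Reachable-trans here       r′ = r′
Reachable-trans (step e r) r′ = step e (Reachable-trans r r′)

Reachable-sym : Reachable G a b → Reachable G b a
Reachable-sym here               = here
Reachable-sym {G = G} (step e r) = Reachable-trans (Reachable-sym r) (step (Edge-sym G e) here)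

Reachable-preserves : (P : Fin n → Set) → (∀ {a b} → Edge G a b → P a → P b) →
                      Reachable G a b → P a → P b
Reachable-preserves P closed here       pa = pa
Reachable-preserves P closed (step e r) pa = Reachable-preserves P closed r (closed e pa)

Reachable-⊆ : {H : Graph n} → (∀ {a b} → Edge G a b → Edge H a b) →
              Reachable G a b → Reachable H a b
Reachable-⊆ G⊆H here       = here
Reachable-⊆ G⊆H (step e r) = step (G⊆H e) (Reachable-⊆ G⊆H r)

connected-via-hub : (c : Fin n) → (∀ a → Reachable G a c) → Connected G
connected-via-hub c to-c a b = Reachable-trans (to-c a) (Reachable-sym (to-c b))

complement²-connected : Connected G → Connected (complement (complement G))
complement²-connected {G = G} conn a b =
  Reachable-⊆ (λ {a} {b} e → trans (complement-involutive G a b) e) (conn a b)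

neighbour : Connected G → a ≢ b → ∃[ c ] Edge G a c
neighbour {a = a} {b} conn a≢b with conn a b
... | here     = ⊥-elim (a≢b refl)
... | step e _ = _ , e

degree-∑ : (G : Graph n) (i : Fin n) → degree G i ≡ ∑ (λ j → 𝟙 (adj G i j))
degree-∑ {n} G i = cong sum (map-tabulate {n = n} id (λ j → 𝟙 (adj G i j)))

foldr-⊓≤init : ∀ m (xs : List ℕ) → foldr _⊓_ m xs ≤ m
foldr-⊓≤init m []       = ≤-refl
foldr-⊓≤init m (x ∷ xs) = ≤-trans (m⊓n≤n x _) (foldr-⊓≤init m xs)

foldr-⊓≤∈ : ∀ m {x} {xs : List ℕ} → x ∈ᴸ xs → foldr _⊓_ m xs ≤ x
foldr-⊓≤∈ m (here refl)  = m⊓n≤m _ _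
foldr-⊓≤∈ m (there x∈xs) = ≤-trans (m⊓n≤n _ _) (foldr-⊓≤∈ m x∈xs)

δ≤n : (G : Graph n) → δ G ≤ n
δ≤n {n} G = foldr-⊓≤init n (map (degree G) (allFin n))

δ≤degree : (G : Graph n) (i : Fin n) → δ G ≤ degree G i
δ≤degree {n} G i = foldr-⊓≤∈ n (∈-map⁺ (degree G) (∈-allFin i))

-- The forcer u may be counted in place of the vertex w it forces.
forcer-degree≤ : (G : Graph n) → u ∈ B → Edge G u w → (∀ x → Edge G u x → x ≢ w → x ∈ B) →
                 degree G u ≤ ∣ B ∣
forcer-degree≤ {n} {u = u} {B} {w} G u∈B uw others = +-cancelʳ-≤ 1 _ _ (begin
  degree G u + 1                      ≡⟨ cong₂ _+_ (degree-∑ G u) (sym (∑-𝟙-≟ u)) ⟩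
  ∑ adjacent + ∑ is-u                 ≡⟨ sym (∑-distrib-+ adjacent is-u) ⟩
  ∑ (λ j → adjacent j + is-u j)       ≤⟨ ∑-mono-≤ swap-forcer ⟩
  ∑ (λ j → black j + is-w j)          ≡⟨ ∑-distrib-+ black is-w ⟩
  ∑ black + ∑ is-w                    ≡⟨ cong₂ _+_ (sym (∣p∣≡∑ B)) (∑-𝟙-≟ w) ⟩
  ∣ B ∣ + 1                           ∎)
  where
  open ≤-Reasoning
  adjacent is-u black is-w : Fin n → ℕ
  adjacent j = 𝟙 (adj G u j)
  is-u     j = 𝟙 (does (u ≟ j))
  black    j = 𝟙 (lookup B j)
  is-w     j = 𝟙 (does (w ≟ j))
  swap-forcer : ∀ j → adjacent j + is-u j ≤ black j + is-w j
  swap-forcer j with u ≟ j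
  ... | yes refl rewrite irref G u | []=⇒lookup u∈B = s≤s z≤n
  ... | no u≢j with w ≟ j
  ...   | yes refl rewrite uw = m≤n+m 1 _
  ...   | no w≢j with adj G u j in uj
  ...     | false = z≤n
  ...     | true rewrite []=⇒lookup (others j uj (w≢j ∘ sym)) = s≤s z≤n

δ≤∣zeroForcingSet∣ : (G : Graph n) → IsZeroForcingSet G S → δ G ≤ ∣ S ∣
δ≤∣zeroForcingSet∣ {n} G ε = subst (δ G ≤_) (sym (∣⊤∣≡n n)) (δ≤n G)
δ≤∣zeroForcingSet∣ G (force u w u∈S _ uw others ◅ _) =
  ≤-trans (δ≤degree G u) (forcer-degree≤ G u∈S uw others)

δ≤Z : (G : Graph n) → IsZeroForcingNumber G z → δ G ≤ z
δ≤Z G ((S , zfs , refl) , _) = δ≤∣zeroForcingSet∣ G zfs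

Z≡δ : (G : Graph n) → IsZeroForcingSet G S → ∣ S ∣ ≡ δ G → IsZeroForcingNumber G (δ G)
Z≡δ G zfs ∣S∣≡δ = (_ , zfs , ∣S∣≡δ) , λ _ → δ≤∣zeroForcingSet∣ G

degree-complement : (G : Graph n) (i : Fin n) → degree (complement G) i + degree G i + 1 ≡ n
degree-complement {n} G i = begin
  degree (complement G) i + degree G i + 1
    ≡⟨ cong₂ _+_ (cong₂ _+_ (degree-∑ (complement G) i) (degree-∑ G i)) (sym (∑-𝟙-≟ i)) ⟩
  ∑ non-adjacent + ∑ adjacent + ∑ equal
    ≡⟨ cong (_+ ∑ equal) (sym (∑-distrib-+ non-adjacent adjacent)) ⟩
  ∑ (λ j → non-adjacent j + adjacent j) + ∑ equal
    ≡⟨ sym (∑-distrib-+ (λ j → non-adjacent j + adjacent j) equal) ⟩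
  ∑ (λ j → non-adjacent j + adjacent j + equal j)
    ≡⟨ ∑-cong exactly-one ⟩
  ∑ {n} (λ _ → 1)
    ≡⟨ trans (∑-const n 1) (*-identityʳ n) ⟩
  n ∎
  where
  open ≡-Reasoning
  non-adjacent adjacent equal : Fin n → ℕ
  non-adjacent j = 𝟙 (adj (complement G) i j)
  adjacent     j = 𝟙 (adj G i j)
  equal        j = 𝟙 (does (i ≟ j))
  exactly-one : ∀ j → non-adjacent j + adjacent j + equal j ≡ 1
  exactly-one j with i ≟ j
  ... | yes refl rewrite irref G i = refl
  ... | no _ with adj G i j
  ...   | true  = refl
  ...   | false = refl

foldr-⊓-map-∸ : ∀ {A : Set} (f : A → ℕ) {c m} → c ≤ m → ∀ x xs →
  foldr _⊓_ m (map (λ a → c ∸ f a) (x ∷ xs)) ≡ c ∸ foldr _⊔_ 0 (map f (x ∷ xs))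
foldr-⊓-map-∸ f {c} c≤m x [] =
  trans (m≤n⇒m⊓n≡m (≤-trans (m∸n≤m c (f x)) c≤m)) (cong (c ∸_) (sym (⊔-identityʳ (f x))))
foldr-⊓-map-∸ f {c} c≤m x (y ∷ xs) =
  trans (cong ((c ∸ f x) ⊓_) (foldr-⊓-map-∸ f c≤m y xs)) (sym (∸-distribˡ-⊔-⊓ c (f x) _))

δ-complement : (G : Graph (suc n)) → δ (complement G) ≡ n ∸ Δ G
δ-complement {n} G =
  trans (cong (foldr _⊓_ (suc n)) (map-cong degree-complement-∸ (allFin (suc n))))
        (foldr-⊓-map-∸ (degree G) (n≤1+n n) zero (tabulate suc))
  where
  degree-complement-∸ : ∀ i → degree (complement G) i ≡ n ∸ degree G i
  degree-complement-∸ i = begin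
    degree (complement G) i
      ≡⟨ m+n∸n≡m _ (degree G i) ⟨
    degree (complement G) i + degree G i ∸ degree G i
      ≡⟨ cong (_∸ degree G i) (suc-injective (trans (+-comm 1 _) (degree-complement G i))) ⟩
    n ∸ degree G i ∎
    where open ≡-Reasoning

ForceStep-∣∣< : ForceStep G B B′ → ∣ B ∣ < ∣ B′ ∣
ForceStep-∣∣< (force {B = B} u w _ w∉B _ _) =
  p⊂q⇒∣p∣<∣q∣ (q⊆p∪q ⁅ w ⁆ B , w , x∈p∪q⁺ (inj₁ (x∈⁅x⁆ w)) , w∉B)

∈-⁅⁆∪⁺ : ∀ {p : Subset n} → (i ≢ a → i ∈ p) → i ∈ ⁅ a ⁆ ∪ p
∈-⁅⁆∪⁺ {i = i} {a} i≢a⇒i∈p with i ≟ a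
... | yes refl = x∈p∪q⁺ (inj₁ (x∈⁅x⁆ i))
... | no i≢a   = x∈p∪q⁺ (inj₂ (i≢a⇒i∈p i≢a))

∉-⁅⁆∪⁺ : ∀ {p : Subset n} → i ≢ a → i ∉ p → i ∉ ⁅ a ⁆ ∪ p
∉-⁅⁆∪⁺ {a = a} {p} i≢a i∉p i∈ = [ i≢a ∘ x∈⁅y⁆⇒x≡y a , i∉p ]′ (x∈p∪q⁻ ⁅ a ⁆ p i∈)

SeparatedNonNeighbours : Graph n → Set
SeparatedNonNeighbours G = ∃[ v ] ∃[ y ] ∃[ z ] ∃[ w ]
  Edge (complement G) v y × Edge (complement G) v z × Edge (complement G) w z × Edge G w y

separatedNonNeighbours? : (G : Graph n) → Dec (SeparatedNonNeighbours G)
separatedNonNeighbours? G = any? λ v → any? λ y → any? λ z → any? λ w →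
  Edge? (complement G) v y ×-dec Edge? (complement G) v z ×-dec
  Edge? (complement G) w z ×-dec Edge? G w y

module _ (G : Graph n) (¬separated : ¬ SeparatedNonNeighbours G) where

  private
    Ḡ = complement G

  nonNeighbours-twins : ∀ {v y z w} → Edge Ḡ v y → Edge Ḡ v z → Edge Ḡ w z → w ≢ y → Edge Ḡ w y
  nonNeighbours-twins {v} {y} {z} {w} vy vz wz w≢y with Edge? G w y
  ... | yes wy = ⊥-elim (¬separated (v , y , z , w , vy , vz , wz , wy))
  ... | no ¬wy = complement-Edge⁺ G w≢y (¬-not ¬wy)

  nonNeighbour-spreads : ∀ {p q a b} → Edge Ḡ p q → Edge Ḡ a q → Edge Ḡ a b →
                         Edge Ḡ b p ⊎ Edge Ḡ b q
  nonNeighbour-spreads {p} {q} {a} {b} pq aq ab = case b ≟ p of λ where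
    (yes refl) → inj₂ pq
    (no b≢p)   → inj₁ (nonNeighbours-twins (Edge-sym Ḡ pq) (Edge-sym Ḡ aq)
                                           (Edge-sym Ḡ ab) b≢p)

  complement-edgeless : Connected G → Connected Ḡ → ¬ Edge Ḡ a b
  complement-edgeless {a = v} {y} connG connḠ vy =
    Edge-irrefl Ḡ (Reachable-preserves (λ u → Edge Ḡ u v) stays-non-neighbour (connG y v)
                                       (Edge-sym Ḡ vy)) refl
    where
    NonNeighbourOfVOrY : Fin n → Set
    NonNeighbourOfVOrY u = Edge Ḡ u v ⊎ Edge Ḡ u y

    everywhere : ∀ u → NonNeighbourOfVOrY u
    everywhere u =
      Reachable-preserves NonNeighbourOfVOrY spread (connḠ y u) (inj₁ (Edge-sym Ḡ vy))
      where
      spread : ∀ {a b} → Edge Ḡ a b → NonNeighbourOfVOrY a → NonNeighbourOfVOrY b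
      spread ab (inj₁ av) = swap (nonNeighbour-spreads (Edge-sym Ḡ vy) av ab)
      spread ab (inj₂ ay) = nonNeighbour-spreads vy ay ab

    stays-non-neighbour : ∀ {a b} → Edge G a b → Edge Ḡ a v → Edge Ḡ b v
    stays-non-neighbour {a} {b} ab av with everywhere b
    ... | inj₁ bv = bv
    ... | inj₂ by = ⊥-elim (Edge-complement-disjoint G ab
      (nonNeighbours-twins (Edge-sym Ḡ by) (Edge-sym Ḡ vy) av (Edge-irrefl G ab)))

separatedNonNeighbours : (G : Graph n) → 2 ≤ n → Connected G → Connected (complement G) →
                         SeparatedNonNeighbours G
separatedNonNeighbours G (s≤s (s≤s _)) connG connḠ =
  decidable-stable (separatedNonNeighbours? G) λ ¬separated →
    complement-edgeless G ¬separated connG connḠ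
      (proj₂ (neighbour {a = zero} {b = suc zero} connḠ λ ()))

separated⇒small-zeroForcingSet : (G : Graph n) → Connected G → SeparatedNonNeighbours G →
                                 ∃[ S ] IsZeroForcingSet G S × 3 + ∣ S ∣ ≤ n
separated⇒small-zeroForcingSet {n} G connG (v , y , z , w , vy , vz , wz , wy) =
  S₀ , force₁ ◅ force₂ ◅ subst (ForceStep G S₂) S₃≡⊤ force₃ ◅ ε , size
  where
  Ḡ = complement G

  x-edge : ∃[ x ] Edge G v x
  x-edge = neighbour connG (Edge-irrefl Ḡ vy)
  x = proj₁ x-edge
  vx = proj₂ x-edge

  f-edge : ∃[ f ] Edge G z f
  f-edge = neighbour connG (Edge-irrefl Ḡ (Edge-sym Ḡ vz))
  f = proj₁ f-edge
  fz = Edge-sym G (proj₂ f-edge)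

  S₀ S₁ S₂ : Subset n
  S₀ = ∁ (⁅ x ⁆ ∪ (⁅ y ⁆ ∪ ⁅ z ⁆))
  S₁ = ⁅ x ⁆ ∪ S₀
  S₂ = ⁅ y ⁆ ∪ S₁

  black₀ : ∀ {t} → t ≢ x → t ≢ y → t ≢ z → t ∈ S₀
  black₀ t≢x t≢y t≢z = x∉p⇒x∈∁p (∉-⁅⁆∪⁺ t≢x (∉-⁅⁆∪⁺ t≢y (x≢y⇒x∉⁅y⁆ t≢z)))
  black₁ : ∀ {t} → t ≢ y → t ≢ z → t ∈ S₁
  black₁ t≢y t≢z = ∈-⁅⁆∪⁺ λ t≢x → black₀ t≢x t≢y t≢z
  black₂ : ∀ {t} → t ≢ z → t ∈ S₂
  black₂ t≢z = ∈-⁅⁆∪⁺ λ t≢y → black₁ t≢y t≢z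

  x∉S₀ : x ∉ S₀
  x∉S₀ = x∈p⇒x∉∁p (x∈p∪q⁺ (inj₁ (x∈⁅x⁆ x)))
  y∉S₁ : y ∉ S₁
  y∉S₁ = ∉-⁅⁆∪⁺ (≢-sym (neighbour≢nonNeighbour G vx vy))
                 (x∈p⇒x∉∁p (x∈p∪q⁺ (inj₂ (x∈p∪q⁺ (inj₁ (x∈⁅x⁆ y))))))
  z∉S₂ : z ∉ S₂
  z∉S₂ = ∉-⁅⁆∪⁺ (≢-sym (neighbour≢nonNeighbour G wy wz))
           (∉-⁅⁆∪⁺ (≢-sym (neighbour≢nonNeighbour G vx vz))
                   (x∈p⇒x∉∁p (x∈p∪q⁺ (inj₂ (x∈p∪q⁺ (inj₂ (x∈⁅x⁆ z)))))))

  force₁ : ForceStep G S₀ S₁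
  force₁ = force v x (black₀ (Edge-irrefl G vx) (Edge-irrefl Ḡ vy) (Edge-irrefl Ḡ vz)) x∉S₀ vx
    λ t vt t≢x → black₀ t≢x (neighbour≢nonNeighbour G vt vy) (neighbour≢nonNeighbour G vt vz)
  force₂ : ForceStep G S₁ S₂
  force₂ = force w y (black₁ (Edge-irrefl G wy) (Edge-irrefl Ḡ wz)) y∉S₁ wy
    λ t wt t≢y → black₁ t≢y (neighbour≢nonNeighbour G wt wz)
  force₃ : ForceStep G S₂ (⁅ z ⁆ ∪ S₂)
  force₃ = force f z (black₂ (Edge-irrefl G fz)) z∉S₂ fz λ t _ t≢z → black₂ t≢z

  S₃≡⊤ : ⁅ z ⁆ ∪ S₂ ≡ ⊤
  S₃≡⊤ = ⊆-antisym ⊆⊤ (λ _ → ∈-⁅⁆∪⁺ black₂)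

  size : 3 + ∣ S₀ ∣ ≤ n
  size = begin
    3 + ∣ S₀ ∣       ≤⟨ +-monoʳ-≤ 2 (ForceStep-∣∣< force₁) ⟩
    2 + ∣ S₁ ∣       ≤⟨ +-monoʳ-≤ 1 (ForceStep-∣∣< force₂) ⟩
    1 + ∣ S₂ ∣       ≤⟨ ForceStep-∣∣< force₃ ⟩
    ∣ ⁅ z ⁆ ∪ S₂ ∣  ≡⟨ cong ∣_∣ S₃≡⊤ ⟩
    ∣ ⊤ {n} ∣       ≡⟨ ∣⊤∣≡n n ⟩
    n               ∎
    where open ≤-Reasoning

Z≤n∸3 : (G : Graph n) → 2 ≤ n → Connected G → Connected (complement G) →
        IsZeroForcingNumber G z → z ≤ n ∸ 3
Z≤n∸3 {n} {z = z} G 2≤n connG connḠ (_ , minimal)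
  with S , zfs , size ← separated⇒small-zeroForcingSet G connG
                           (separatedNonNeighbours G 2≤n connG connḠ) =
  m+n≤o⇒m≤o∸n z (subst (_≤ n) (+-comm 3 z) (≤-trans (+-monoʳ-≤ 3 (minimal S zfs)) size))

CanForce : Graph n → Subset n → Fin n → Fin n → Set
CanForce G B u w = u ∈ B × w ∉ B × Edge G u w × (∀ x → Edge G u x → x ≢ w → x ∈ B)

canForce? : (G : Graph n) (B : Subset n) (u w : Fin n) → Dec (CanForce G B u w)
canForce? G B u w = u ∈? B ×-dec ¬? (w ∈? B) ×-dec Edge? G u w ×-dec
  all? λ x → Edge? G u x →-dec (¬? (x ≟ w) →-dec x ∈? B)

forced : (G : Graph n) {B : Subset n} (u w : Fin n) {_ : True (canForce? G B u w)} →
         ForceStep G B (⁅ w ⁆ ∪ B)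
forced G u w {can} with u∈B , w∉B , uw , others ← toWitness can = force u w u∈B w∉B uw others

suc-≡ᵇ-false : ∀ k → (suc k ≡ᵇ k) ≡ false
suc-≡ᵇ-false zero    = refl
suc-≡ᵇ-false (suc k) = suc-≡ᵇ-false k

path : ∀ n → Graph n
path n = record
  { adj   = λ i j → (suc (toℕ i) ≡ᵇ toℕ j) ∨ (suc (toℕ j) ≡ᵇ toℕ i)
  ; sym   = λ i j → ∨-comm (suc (toℕ i) ≡ᵇ toℕ j) _
  ; irref = λ i → cong₂ _∨_ (suc-≡ᵇ-false (toℕ i)) (suc-≡ᵇ-false (toℕ i))
  }

P₄ : Graph 4
P₄ = path 4

P₄-connected : Connected P₄
P₄-connected = connected-via-hub zero λ where
  zero                   → here
  (suc zero)             → step refl here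
  (suc (suc zero))       → step {j = # 1} refl (step refl here)
  (suc (suc (suc zero))) → step {j = # 2} refl (step {j = # 1} refl (step refl here))

-- The complement of P₄ is the path 2 − 0 − 3 − 1.
P₄ᶜ : Graph 4
P₄ᶜ = complement P₄

P₄ᶜ-connected : Connected P₄ᶜ
P₄ᶜ-connected = connected-via-hub zero λ where
  zero                   → here
  (suc zero)             → step {j = # 3} refl (step refl here)
  (suc (suc zero))       → step refl here
  (suc (suc (suc zero))) → step refl here

Z-P₄ : IsZeroForcingNumber P₄ 1
Z-P₄ = Z≡δ {S = ⁅ # 0 ⁆} P₄
  (forced P₄ (# 0) (# 1) ◅ forced P₄ (# 1) (# 2) ◅ forced P₄ (# 2) (# 3) ◅ ε) refl

Z-P₄ᶜ : IsZeroForcingNumber P₄ᶜ 1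
Z-P₄ᶜ = Z≡δ {S = ⁅ # 2 ⁆} P₄ᶜ
  (forced P₄ᶜ (# 2) (# 0) ◅ forced P₄ᶜ (# 0) (# 3) ◅ forced P₄ᶜ (# 3) (# 1) ◅ ε) refl

corollary2p8 : ((n : ℕ) (G : Graph n) → 4 ≤ n → Connected G → Connected (complement G) →
    (z zc : ℕ) → IsZeroForcingNumber G z → IsZeroForcingNumber (complement G) zc →
    (δ G + (n ∸ 1 ∸ Δ G) ≡ δ G + δ (complement G)) ×
    (δ G + δ (complement G) ≤ z + zc) ×
    (z + zc ≤ 2 * (n ∸ 3)))
    ×
    (Σ ℕ λ n → Σ (Graph n) λ G → 4 ≤ n × Connected G × Connected (complement G) ×
    Σ ℕ λ z → Σ ℕ λ zc → IsZeroForcingNumber G z × IsZeroForcingNumber (complement G) zc ×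
    δ G + δ (complement G) ≡ z + zc)
    ×
    (Σ ℕ λ n → Σ (Graph n) λ G → 4 ≤ n × Connected G × Connected (complement G) ×
    Σ ℕ λ z → Σ ℕ λ zc → IsZeroForcingNumber G z × IsZeroForcingNumber (complement G) zc ×
    z + zc ≡ 2 * (n ∸ 3))
corollary2p8 =
  (λ { _ G (s≤s (s≤s (s≤s (s≤s _)))) connG connḠ z z̄ Z Z̄ →
    cong (δ G +_) (sym (δ-complement G)) ,
    +-mono-≤ (δ≤Z G Z) (δ≤Z (complement G) Z̄) ,
    +-mono-≤ (Z≤n∸3 G 2≤4+m connG connḠ Z)
             (subst (z̄ ≤_) (sym (+-identityʳ _))
                    (Z≤n∸3 (complement G) 2≤4+m connḠ (complement²-connected connG) Z̄)) }) ,
  (4 , P₄ , ≤-refl , P₄-connected , P₄ᶜ-connected , 1 , 1 , Z-P₄ , Z-P₄ᶜ , refl) ,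
  (4 , P₄ , ≤-refl , P₄-connected , P₄ᶜ-connected , 1 , 1 , Z-P₄ , Z-P₄ᶜ , refl)
  where
  2≤4+m : ∀ {m} → 2 ≤ 4 + m
  2≤4+m = s≤s (s≤s z≤n)
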